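{- Let $A$, $B$, $C$ be filiform games, $\sigma$ a strategy on $A\multimap B$ and $\tau$ a strategy on $B\multimap C$. Let $\le_{\tau\circ\sigma}$ be the restriction to the moves of $A\multimap C$ of the transitive closure of the relation $\le_\sigma\cup\le_\tau$ (on $M_A\uplus M_B\uplus M_C$, the moves of $B$ being shared). Then $\le_{\tau\circ\sigma}$ is a strategy on $A\multimap C$; in particular it is acyclic.
   Context: A game $A=(M_A,\lambda_A,\le_A)$ is a set of moves $M_A$, a polarity $\lambda_A:M_A\to\{ -1,+1\}$ ($+1$: Proponent, $-1$: Opponent) and a partial order $\le_A$ in which every move has finitely many predecessors; it is filiform if $\le_A$ is a total order. $A\otimes B$ is the disjoint union of moves, polarities and orders; $A^*$ is $A$ with polarities negated; $A\multimap B=A^*\otimes B$. A strategy on a game $G$ is a partial order $\le_\sigma$ on $M_G$ such that $\le_\sigma\cup\le_G$ is acyclic (the two orders are compatible) and $m<_\sigma n$ implies $\lambda_G(m)=-1$ and $\lambda_G(n)=+1$. -}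

module Defs where

open import Level using (0ℓ)
open import Data.Sum using (_⊎_; inj₁; inj₂)
open import Data.Product using (Σ; ∃; _×_; _,_)
open import Data.List using (List)
open import Data.List.Membership.Propositional using (_∈_)
open import Relation.Binary.Core using (Rel)
open import Relation.Binary.Structures using (IsPartialOrder)
open import Relation.Binary.Definitions using (Total)
open import Relation.Binary.PropositionalEquality using (_≡_; _≢_)
open import Relation.Binary.Construct.Union using (_∪_)
open import Relation.Binary.Construct.Closure.Transitive using (TransClosure)
open import Relation.Nullary using (¬_)

-- Polarities: pos = +1 (Proponent), neg = -1 (Opponent)
data Pol : Set where
  pos neg : Pol

negate : Pol → Pol
negate pos = neg
negate neg = pos

record Arena : Set₁ where
  field
    M   : Set
    pol : M → Pol
    _≤_ : Rel M 0ℓ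
open Arena public

record IsGame (A : Arena) : Set where
  field
    isPartialOrder : IsPartialOrder _≡_ (_≤_ A)
    finitePred     : ∀ (m : M A) → Σ (List (M A)) λ xs → ∀ n → _≤_ A n m → n ∈ xs

record IsFiliform (A : Arena) : Set where
  field
    isGame : IsGame A
    total  : Total (_≤_ A)

data SumRel {X Y : Set} (R : Rel X 0ℓ) (S : Rel Y 0ℓ) : Rel (X ⊎ Y) 0ℓ where
  inj₁ : ∀ {x x'} → R x x' → SumRel R S (inj₁ x) (inj₁ x')
  inj₂ : ∀ {y y'} → S y y' → SumRel R S (inj₂ y) (inj₂ y')

sumPol : {X Y : Set} → (X → Pol) → (Y → Pol) → X ⊎ Y → Pol
sumPol p q (inj₁ x) = p x
sumPol p q (inj₂ y) = q y

_⊗_ : Arena → Arena → Arena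
A ⊗ B = record { M = M A ⊎ M B ; pol = sumPol (pol A) (pol B) ; _≤_ = SumRel (_≤_ A) (_≤_ B) }

_^* : Arena → Arena
A ^* = record { M = M A ; pol = λ m → negate (pol A m) ; _≤_ = _≤_ A }

_⊸_ : Arena → Arena → Arena
A ⊸ B = (A ^*) ⊗ B

Strict : {X : Set} → Rel X 0ℓ → Rel X 0ℓ
Strict R x y = R x y × x ≢ y

Acyclic : {X : Set} → Rel X 0ℓ → Set
Acyclic R = ∀ x → ¬ TransClosure (Strict R) x x

record IsStrategy (G : Arena) (_≤σ_ : Rel (M G) 0ℓ) : Set where
  field
    isPartialOrder : IsPartialOrder _≡_ _≤σ_
    compatible     : Acyclic (_≤σ_ ∪ _≤_ G)
    polarity       : ∀ m n → Strict _≤σ_ m n → (pol G m ≡ neg) × (pol G n ≡ pos)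

Mov3 : Arena → Arena → Arena → Set
Mov3 A B C = M A ⊎ (M B ⊎ M C)

embAB : {A B C : Arena} → M A ⊎ M B → Mov3 A B C
embAB (inj₁ a) = inj₁ a
embAB (inj₂ b) = inj₂ (inj₁ b)

embBC : {A B C : Arena} → M B ⊎ M C → Mov3 A B C
embBC (inj₁ b) = inj₂ (inj₁ b)
embBC (inj₂ c) = inj₂ (inj₂ c)

embAC : {A B C : Arena} → M A ⊎ M C → Mov3 A B C
embAC (inj₁ a) = inj₁ a
embAC (inj₂ c) = inj₂ (inj₂ c)

data Interact (A B C : Arena) (σ : Rel (M A ⊎ M B) 0ℓ) (τ : Rel (M B ⊎ M C) 0ℓ)
     : Rel (Mov3 A B C) 0ℓ where
  inσ : ∀ {m n} → σ m n → Interact A B C σ τ (embAB {A} {B} {C} m) (embAB {A} {B} {C} n)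
  inτ : ∀ {m n} → τ m n → Interact A B C σ τ (embBC {A} {B} {C} m) (embBC {A} {B} {C} n)

compose : (A B C : Arena) → Rel (M A ⊎ M B) 0ℓ → Rel (M B ⊎ M C) 0ℓ → Rel (M A ⊎ M C) 0ℓ
compose A B C σ τ m n =
  TransClosure (Interact A B C σ τ) (embAC {A} {B} {C} m) (embAC {A} {B} {C} n)

module Submission where

-- The heart of the argument is a statement about relations: glue an
-- acyclic relation R on A ⊎ B and an acyclic relation S on B ⊎ C along
-- their common part B; if both contain the order of B and that order is
-- total, the glued relation is again acyclic (Gluing.glue-acyclic).  A
-- strict R-path between two B-moves must climb strictly in B (climbs),
-- so along any glued path leaving a B-move b every later B-move lies
-- strictly above b; a cycle through B is therefore impossible, and a
-- cycle avoiding B stays inside A (or C) and is an R-cycle (or S-cycle).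
--
-- Applied to R = σ ∪ ≤(A ⊸ B) and S = τ ∪ ≤(B ⊸ C), acyclicity of the
-- interaction graph yields all three properties of τ ∘ σ: compatibility
-- (a cycle of τ ∘ σ ∪ ≤(A ⊸ C) unfolds to a graph cycle), antisymmetry
-- (a composite path from A to A that could return must stay in A, hence
-- is a σ-path) and polarity (the first and last strict steps of a
-- composite path are strict σ- or τ-steps).  Equality of moves is not
-- decidable, so strictness of paths is only recovered under double
-- negation, which is harmless since the goals there are ⊥ or equalities
-- of polarities.

open import Defs
open import Level using (0ℓ)
open import Data.Empty using (⊥; ⊥-elim)
open import Data.Product using (∃; _×_; _,_; proj₁; proj₂)
open import Data.Sum using (_⊎_; inj₁; inj₂)
open import Data.Sum.Properties using (inj₁-injective; inj₂-injective)
open import Function using (id; _∘_)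
open import Relation.Binary.Core using (Rel; _⇒_)
open import Relation.Binary.Definitions using (Total)
open import Relation.Binary.Structures using (IsPartialOrder; IsTotalOrder)
open import Relation.Binary.PropositionalEquality
  using (_≡_; _≢_; refl; sym; cong; subst; isEquivalence)
open import Relation.Binary.Construct.Union using (_∪_)
open import Relation.Binary.Construct.Closure.Transitive
  using (TransClosure; [_]; _∷_; _∷ʳ_; _++_; transitive⁻)
import Relation.Binary.Construct.NonStrictToStrict as NonStrictToStrict
open import Relation.Nullary using (¬_; Dec; yes; no)
open import Relation.Nullary.Negation using (Stable; ¬¬-map)
open import Relation.Nullary.Decidable using (¬¬-excluded-middle)

pattern inA a = inj₁ a
pattern inB b = inj₂ (inj₁ b)
pattern inC c = inj₂ (inj₂ c)

module _ {X : Set} {R : Rel X 0ℓ} where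

  ⁺-bind : {Y : Set} {S : Rel Y 0ℓ} (f : X → Y) →
    (∀ {x y} → R x y → TransClosure S (f x) (f y)) →
    ∀ {x y} → TransClosure R x y → TransClosure S (f x) (f y)
  ⁺-bind f g [ r ]     = g r
  ⁺-bind f g (r ∷ rs) = g r ++ ⁺-bind f g rs

  ⁺-map : {S : Rel X 0ℓ} → R ⇒ S → TransClosure R ⇒ TransClosure S
  ⁺-map g = ⁺-bind id ([_] ∘ g)

  ⁺-preserves : {P : X → Set} → (∀ {y z} → P y → R y z → P z) →
    ∀ {x y} → P x → TransClosure R x y → P y
  ⁺-preserves step px [ r ]    = step px r
  ⁺-preserves step px (r ∷ rs) = ⁺-preserves step (step px r) rs

  first-step : ∀ {x y} → TransClosure R x y → ∃ λ z → R x z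
  first-step [ r ]   = _ , r
  first-step (r ∷ _) = _ , r

  last-step : ∀ {x y} → TransClosure R x y → ∃ λ z → R z y
  last-step [ r ]    = _ , r
  last-step (_ ∷ rs) = last-step rs

  prepend : ∀ {x y z} → R x y → Dec (x ≡ y) →
    y ≡ z ⊎ TransClosure (Strict R) y z → x ≡ z ⊎ TransClosure (Strict R) x z
  prepend r (yes refl) rest       = rest
  prepend r (no x≢y) (inj₁ refl) = inj₂ [ r , x≢y ]
  prepend r (no x≢y) (inj₂ p)    = inj₂ ((r , x≢y) ∷ p)

  -- Under double negation, a path either joins equal endpoints or can be
  -- made strict by dropping its loops (equality is not decidable).
  strictify : ∀ {x y} → TransClosure R x y →
    ¬ ¬ (x ≡ y ⊎ TransClosure (Strict R) x y)
  strictify [ r ]           = ¬¬-map (λ x≟y → prepend r x≟y (inj₁ refl)) ¬¬-excluded-middle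
  strictify (r ∷ rs) ¬goal = strictify rs λ rest →
    ¬¬-excluded-middle λ x≟y → ¬goal (prepend r x≟y rest)

  no-round-trip : Acyclic R → ∀ {x y} →
    TransClosure R x y → TransClosure R y x → x ≢ y → ⊥
  no-round-trip acyclic p q x≢y = strictify p λ where
    (inj₁ x≡y) → x≢y x≡y
    (inj₂ p′)  → strictify q λ where
      (inj₁ y≡x) → x≢y (sym y≡x)
      (inj₂ q′)  → acyclic _ (p′ ++ q′)

module _ {X Y : Set} {_≤_ : Rel Y 0ℓ} where
  open NonStrictToStrict _≡_ _≤_ using (_<_)

  climbs : {R : Rel X 0ℓ} (f : Y → X) → Total _≤_ →
    (∀ {u v} → u ≤ v → R (f u) (f v)) → Acyclic R →
    ∀ {u v} → TransClosure (Strict R) (f u) (f v) → u < v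
  climbs {R} f total ≤⊆R acyclic {u} {v} p with total u v
  ... | inj₁ u≤v = u≤v , λ { refl → acyclic _ p }
  ... | inj₂ v≤u = ⊥-elim (acyclic _ (p ∷ʳ (≤⊆R v≤u , v≢u)))
    where
    v≢u : f v ≢ f u
    v≢u e = acyclic _ (subst (TransClosure (Strict R) (f u)) e p)

pol-stable : {p q : Pol} → Stable (p ≡ q)
pol-stable {pos} {pos} _  = refl
pol-stable {pos} {neg} ¬¬e = ⊥-elim (¬¬e λ ())
pol-stable {neg} {pos} ¬¬e = ⊥-elim (¬¬e λ ())
pol-stable {neg} {neg} _  = refl

module Interaction (A B C : Arena) where

  -- Defs.Interact, presented by the kind of its endpoints: a step given by
  -- R inside A ⊎ B or by S inside B ⊎ C.  Concrete indices make it
  -- amenable to case analysis on the positions.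
  data Step (R : Rel (M A ⊎ M B) 0ℓ) (S : Rel (M B ⊎ M C) 0ℓ)
       : Rel (Mov3 A B C) 0ℓ where
    AA  : ∀ {a a′} → R (inj₁ a) (inj₁ a′) → Step R S (inA a) (inA a′)
    AB  : ∀ {a b}  → R (inj₁ a) (inj₂ b)  → Step R S (inA a) (inB b)
    BA  : ∀ {b a}  → R (inj₂ b) (inj₁ a)  → Step R S (inB b) (inA a)
    BBᴿ : ∀ {b b′} → R (inj₂ b) (inj₂ b′) → Step R S (inB b) (inB b′)
    BBˢ : ∀ {b b′} → S (inj₁ b) (inj₁ b′) → Step R S (inB b) (inB b′)
    BC  : ∀ {b c}  → S (inj₁ b) (inj₂ c)  → Step R S (inB b) (inC c)
    CB  : ∀ {c b}  → S (inj₂ c) (inj₁ b)  → Step R S (inC c) (inB b)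
    CC  : ∀ {c c′} → S (inj₂ c) (inj₂ c′) → Step R S (inC c) (inC c′)

  module _ {R : Rel (M A ⊎ M B) 0ℓ} {S : Rel (M B ⊎ M C) 0ℓ} where

    fromInteract : Interact A B C R S ⇒ Step R S
    fromInteract (inσ {inj₁ _} {inj₁ _} r) = AA r
    fromInteract (inσ {inj₁ _} {inj₂ _} r) = AB r
    fromInteract (inσ {inj₂ _} {inj₁ _} r) = BA r
    fromInteract (inσ {inj₂ _} {inj₂ _} r) = BBᴿ r
    fromInteract (inτ {inj₁ _} {inj₁ _} s) = BBˢ s
    fromInteract (inτ {inj₁ _} {inj₂ _} s) = BC s
    fromInteract (inτ {inj₂ _} {inj₁ _} s) = CB s
    fromInteract (inτ {inj₂ _} {inj₂ _} s) = CC s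

    Step-mono : {R′ : Rel (M A ⊎ M B) 0ℓ} {S′ : Rel (M B ⊎ M C) 0ℓ} →
      R ⇒ R′ → S ⇒ S′ → Step R S ⇒ Step R′ S′
    Step-mono f g (AA r)  = AA (f r)
    Step-mono f g (AB r)  = AB (f r)
    Step-mono f g (BA r)  = BA (f r)
    Step-mono f g (BBᴿ r) = BBᴿ (f r)
    Step-mono f g (BBˢ s) = BBˢ (g s)
    Step-mono f g (BC s)  = BC (g s)
    Step-mono f g (CB s)  = CB (g s)
    Step-mono f g (CC s)  = CC (g s)

    strict-step : Strict (Step R S) ⇒ Step (Strict R) (Strict S)
    strict-step (AA r , ≢)  = AA (r , ≢ ∘ cong (embAB {A} {B} {C}))
    strict-step (AB r , ≢)  = AB (r , ≢ ∘ cong (embAB {A} {B} {C}))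
    strict-step (BA r , ≢)  = BA (r , ≢ ∘ cong (embAB {A} {B} {C}))
    strict-step (BBᴿ r , ≢) = BBᴿ (r , ≢ ∘ cong (embAB {A} {B} {C}))
    strict-step (BBˢ s , ≢) = BBˢ (s , ≢ ∘ cong (embBC {A} {B} {C}))
    strict-step (BC s , ≢)  = BC (s , ≢ ∘ cong (embBC {A} {B} {C}))
    strict-step (CB s , ≢)  = CB (s , ≢ ∘ cong (embBC {A} {B} {C}))
    strict-step (CC s , ≢)  = CC (s , ≢ ∘ cong (embBC {A} {B} {C}))

    -- A path between two A-moves either stays in A, where it is an R-path,
    -- or passes through a B-move (moves of C are not adjacent to A).
    exitA : ∀ {a a′} → TransClosure (Step R S) (inA a) (inA a′) →
      TransClosure R (inj₁ a) (inj₁ a′) ⊎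
      ∃ λ b → TransClosure (Step R S) (inA a) (inB b) × TransClosure (Step R S) (inB b) (inA a′)
    exitA [ AA r ] = inj₁ [ r ]
    exitA (AA r ∷ p) with exitA p
    ... | inj₁ q              = inj₁ (r ∷ q)
    ... | inj₂ (b , p₁ , p₂) = inj₂ (b , AA r ∷ p₁ , p₂)
    exitA (AB r ∷ p) = inj₂ (_ , [ AB r ] , p)

    exitC : ∀ {c c′} → TransClosure (Step R S) (inC c) (inC c′) →
      TransClosure S (inj₂ c) (inj₂ c′) ⊎
      ∃ λ b → TransClosure (Step R S) (inC c) (inB b) × TransClosure (Step R S) (inB b) (inC c′)
    exitC [ CC s ] = inj₁ [ s ]
    exitC (CC s ∷ p) with exitC p
    ... | inj₁ q              = inj₁ (s ∷ q)
    ... | inj₂ (b , p₁ , p₂) = inj₂ (b , CC s ∷ p₁ , p₂)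
    exitC (CB s ∷ p) = inj₂ (_ , [ CB s ] , p)

module Gluing (A B C : Arena) (≤B-isTotalOrder : IsTotalOrder _≡_ (_≤_ B))
  {R : Rel (M A ⊎ M B) 0ℓ} {S : Rel (M B ⊎ M C) 0ℓ}
  (R-acyclic : Acyclic R) (S-acyclic : Acyclic S)
  (≤B⊆R : ∀ {b b′} → _≤_ B b b′ → R (inj₂ b) (inj₂ b′))
  (≤B⊆S : ∀ {b b′} → _≤_ B b b′ → S (inj₁ b) (inj₁ b′))
  where

  open Interaction A B C
  open IsTotalOrder ≤B-isTotalOrder
    using (total; antisym; ≤-respˡ-≈) renaming (refl to ≤B-refl; trans to ≤B-trans)
  open NonStrictToStrict _≡_ (_≤_ B) using (_<_; <-irrefl; ≤-<-trans)

  _≤B_ : Rel (M B) 0ℓ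
  _≤B_ = _≤_ B

  ≤-<B-trans : ∀ {b₁ b₂ b₃} → b₁ ≤B b₂ → b₂ < b₃ → b₁ < b₃
  ≤-<B-trans = ≤-<-trans ≤B-trans antisym ≤-respˡ-≈

  climbsR : ∀ {b b′} → TransClosure (Strict R) (inj₂ b) (inj₂ b′) → b < b′
  climbsR = climbs inj₂ total ≤B⊆R R-acyclic

  climbsS : ∀ {b b′} → TransClosure (Strict S) (inj₁ b) (inj₁ b′) → b < b′
  climbsS = climbs inj₁ total ≤B⊆S S-acyclic

  Glued : Rel (Mov3 A B C) 0ℓ
  Glued = Step (Strict R) (Strict S)

  -- The invariant along a glued path leaving the B-move b: B-moves lie
  -- strictly above b; A-moves (C-moves) are reached by a strict R-path
  -- (S-path) from a B-move at or above b.
  Above : M B → Mov3 A B C → Set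
  Above b (inA a)  = ∃ λ b′ → b ≤B b′ × TransClosure (Strict R) (inj₂ b′) (inj₁ a)
  Above b (inB b′) = b < b′
  Above b (inC c)  = ∃ λ b′ → b ≤B b′ × TransClosure (Strict S) (inj₁ b′) (inj₂ c)

  leaveB : ∀ {b b′ y} → b ≤B b′ → Glued (inB b′) y → Above b y
  leaveB b≤b′ (BA r)  = _ , b≤b′ , [ r ]
  leaveB b≤b′ (BBᴿ r) = ≤-<B-trans b≤b′ (climbsR [ r ])
  leaveB b≤b′ (BBˢ s) = ≤-<B-trans b≤b′ (climbsS [ s ])
  leaveB b≤b′ (BC s)  = _ , b≤b′ , [ s ]

  advance : ∀ {b y z} → Above b y → Glued y z → Above b z
  advance (b′ , b≤b′ , p) (AA r) = b′ , b≤b′ , p ∷ʳ r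
  advance (b′ , b≤b′ , p) (AB r) = ≤-<B-trans b≤b′ (climbsR (p ∷ʳ r))
  advance {y = inB _} b<b′ s     = leaveB (proj₁ b<b′) s
  advance (b′ , b≤b′ , p) (CB s) = ≤-<B-trans b≤b′ (climbsS (p ∷ʳ s))
  advance (b′ , b≤b′ , p) (CC s) = b′ , b≤b′ , p ∷ʳ s

  -- Along a cycle through b the invariant would give b < b.
  no-cycle-B : ∀ {b} → ¬ TransClosure Glued (inB b) (inB b)
  no-cycle-B [ s ]    = <-irrefl refl (leaveB ≤B-refl s)
  no-cycle-B (s ∷ p) = <-irrefl refl (⁺-preserves advance (leaveB ≤B-refl s) p)

  -- A cycle through A either stays in A, contradicting acyclicity of R, or
  -- can be rotated into a cycle through B.
  no-cycle-A : ∀ {a} → ¬ TransClosure Glued (inA a) (inA a)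
  no-cycle-A p with exitA p
  ... | inj₁ q              = R-acyclic _ q
  ... | inj₂ (_ , p₁ , p₂) = no-cycle-B (p₂ ++ p₁)

  no-cycle-C : ∀ {c} → ¬ TransClosure Glued (inC c) (inC c)
  no-cycle-C p with exitC p
  ... | inj₁ q              = S-acyclic _ q
  ... | inj₂ (_ , p₁ , p₂) = no-cycle-B (p₂ ++ p₁)

  glue-acyclic : Acyclic (Step R S)
  glue-acyclic (inA _) = no-cycle-A ∘ ⁺-map strict-step
  glue-acyclic (inB _) = no-cycle-B ∘ ⁺-map strict-step
  glue-acyclic (inC _) = no-cycle-C ∘ ⁺-map strict-step

module Composition (A B C : Arena) (≤B-isTotalOrder : IsTotalOrder _≡_ (_≤_ B))
  (σ : Rel (M (A ⊸ B)) 0ℓ) (τ : Rel (M (B ⊸ C)) 0ℓ)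
  (σ-strategy : IsStrategy (A ⊸ B) σ) (τ-strategy : IsStrategy (B ⊸ C) τ)
  where

  open Interaction A B C
  module σ = IsStrategy σ-strategy
  module τ = IsStrategy τ-strategy
  module σ-order = IsPartialOrder σ.isPartialOrder
  module τ-order = IsPartialOrder τ.isPartialOrder

  τ∘σ : Rel (M (A ⊸ C)) 0ℓ
  τ∘σ = compose A B C σ τ

  embAC′ : M (A ⊸ C) → Mov3 A B C
  embAC′ = embAC {A} {B} {C}

  embAC-injective : ∀ {m n} → embAC′ m ≡ embAC′ n → m ≡ n
  embAC-injective {inj₁ _} {inj₁ _} refl = refl
  embAC-injective {inj₂ _} {inj₂ _} refl = refl

  Graph : Rel (Mov3 A B C) 0ℓ
  Graph = Step (σ ∪ _≤_ (A ⊸ B)) (τ ∪ _≤_ (B ⊸ C))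

  graph-acyclic : Acyclic Graph
  graph-acyclic = Gluing.glue-acyclic A B C ≤B-isTotalOrder
    σ.compatible τ.compatible (λ b≤b′ → inj₂ (inj₂ b≤b′)) (λ b≤b′ → inj₂ (inj₁ b≤b′))

  as-step-path : ∀ {m n} → τ∘σ m n → TransClosure (Step σ τ) (embAC′ m) (embAC′ n)
  as-step-path = ⁺-map fromInteract

  to-graph : ∀ {x y} → TransClosure (Step σ τ) x y → TransClosure Graph x y
  to-graph = ⁺-map (Step-mono inj₁ inj₁)

  as-graph-path : ∀ {m n} → τ∘σ m n → TransClosure Graph (embAC′ m) (embAC′ n)
  as-graph-path = to-graph ∘ as-step-path

  τ∘σ-refl : ∀ {m} → τ∘σ m m
  τ∘σ-refl {inj₁ a} = [ inσ {m = inj₁ a} {n = inj₁ a} σ-order.refl ]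
  τ∘σ-refl {inj₂ c} = [ inτ {m = inj₂ c} {n = inj₂ c} τ-order.refl ]

  -- A composite path between A-moves with a way back never visits B (that
  -- would be a graph round trip through a B-move), so it is a σ-path, and
  -- σ is transitive.
  stays-in-A : ∀ {a a′} → τ∘σ (inj₁ a) (inj₁ a′) → τ∘σ (inj₁ a′) (inj₁ a) →
    σ (inj₁ a) (inj₁ a′)
  stays-in-A p back with exitA (as-step-path p)
  ... | inj₁ q              = transitive⁻ σ σ-order.trans q
  ... | inj₂ (_ , p₁ , p₂) = ⊥-elim (no-round-trip graph-acyclic
    (to-graph p₁) (to-graph p₂ ++ as-graph-path back) λ ())

  stays-in-C : ∀ {c c′} → τ∘σ (inj₂ c) (inj₂ c′) → τ∘σ (inj₂ c′) (inj₂ c) →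
    τ (inj₂ c) (inj₂ c′)
  stays-in-C p back with exitC (as-step-path p)
  ... | inj₁ q              = transitive⁻ τ τ-order.trans q
  ... | inj₂ (_ , p₁ , p₂) = ⊥-elim (no-round-trip graph-acyclic
    (to-graph p₁) (to-graph p₂ ++ as-graph-path back) λ ())

  -- Mutually reachable moves are equal: inside A (or C) by antisymmetry of
  -- σ (or τ), while an A-move and a C-move are never mutually reachable.
  τ∘σ-antisym : ∀ {m n} → τ∘σ m n → τ∘σ n m → m ≡ n
  τ∘σ-antisym {inj₁ _} {inj₁ _} p q =
    cong inj₁ (inj₁-injective (σ-order.antisym (stays-in-A p q) (stays-in-A q p)))
  τ∘σ-antisym {inj₂ _} {inj₂ _} p q =
    cong inj₂ (inj₂-injective (τ-order.antisym (stays-in-C p q) (stays-in-C q p)))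
  τ∘σ-antisym {inj₁ _} {inj₂ _} p q =
    ⊥-elim (no-round-trip graph-acyclic (as-graph-path p) (as-graph-path q) λ ())
  τ∘σ-antisym {inj₂ _} {inj₁ _} p q =
    ⊥-elim (no-round-trip graph-acyclic (as-graph-path p) (as-graph-path q) λ ())

  τ∘σ-isPartialOrder : IsPartialOrder _≡_ τ∘σ
  τ∘σ-isPartialOrder = record
    { isPreorder = record
      { isEquivalence = isEquivalence
      ; reflexive     = λ { refl → τ∘σ-refl }
      ; trans         = _++_
      }
    ; antisym    = τ∘σ-antisym
    }

  -- τ ∘ σ is compatible with A ⊸ C: each step of τ ∘ σ ∪ ≤(A ⊸ C) unfolds
  -- to a graph path, so a strict cycle would be a graph round trip.
  unfold : ∀ {m n} → (τ∘σ ∪ _≤_ (A ⊸ C)) m n → TransClosure Graph (embAC′ m) (embAC′ n)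
  unfold (inj₁ p)          = as-graph-path p
  unfold (inj₂ (inj₁ a≤a′)) = [ AA (inj₂ (inj₁ a≤a′)) ]
  unfold (inj₂ (inj₂ c≤c′)) = [ CC (inj₂ (inj₂ c≤c′)) ]

  τ∘σ-compatible : Acyclic (τ∘σ ∪ _≤_ (A ⊸ C))
  τ∘σ-compatible _ [ (_ , m≢m) ]     = m≢m refl
  τ∘σ-compatible _ ((s , m≢n) ∷ p) =
    no-round-trip graph-acyclic (unfold s) (⁺-bind embAC′ (unfold ∘ proj₁) p)
      (m≢n ∘ embAC-injective)

  -- τ ∘ σ respects polarities: a strict composite path starts with a strict
  -- σ- or τ-step out of its source and ends with one into its target.
  strict-path : ∀ {m n} → Strict τ∘σ m n →
    ¬ ¬ TransClosure (Step (Strict σ) (Strict τ)) (embAC′ m) (embAC′ n)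
  strict-path {m} {n} (p , m≢n) = ¬¬-map strict-or-absurd (strictify (as-step-path p))
    where
    strict-or-absurd : embAC′ m ≡ embAC′ n ⊎ TransClosure (Strict (Step σ τ)) (embAC′ m) (embAC′ n) →
      TransClosure (Step (Strict σ) (Strict τ)) (embAC′ m) (embAC′ n)
    strict-or-absurd (inj₁ e) = ⊥-elim (m≢n (embAC-injective e))
    strict-or-absurd (inj₂ q) = ⁺-map strict-step q

  source-neg : ∀ {m y} → Step (Strict σ) (Strict τ) (embAC′ m) y → pol (A ⊸ C) m ≡ neg
  source-neg {inj₁ _} (AA r) = proj₁ (σ.polarity _ _ r)
  source-neg {inj₁ _} (AB r) = proj₁ (σ.polarity _ _ r)
  source-neg {inj₂ _} (CB s) = proj₁ (τ.polarity _ _ s)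
  source-neg {inj₂ _} (CC s) = proj₁ (τ.polarity _ _ s)

  target-pos : ∀ {n y} → Step (Strict σ) (Strict τ) y (embAC′ n) → pol (A ⊸ C) n ≡ pos
  target-pos {inj₁ _} (AA r) = proj₂ (σ.polarity _ _ r)
  target-pos {inj₁ _} (BA r) = proj₂ (σ.polarity _ _ r)
  target-pos {inj₂ _} (BC s) = proj₂ (τ.polarity _ _ s)
  target-pos {inj₂ _} (CC s) = proj₂ (τ.polarity _ _ s)

  τ∘σ-polarity : ∀ m n → Strict τ∘σ m n → (pol (A ⊸ C) m ≡ neg) × (pol (A ⊸ C) n ≡ pos)
  τ∘σ-polarity _ _ m<n =
    pol-stable (¬¬-map (source-neg ∘ proj₂ ∘ first-step) (strict-path m<n)) ,
    pol-stable (¬¬-map (target-pos ∘ proj₂ ∘ last-step) (strict-path m<n))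

  isStrategy : IsStrategy (A ⊸ C) τ∘σ
  isStrategy = record
    { isPartialOrder = τ∘σ-isPartialOrder
    ; compatible     = τ∘σ-compatible
    ; polarity       = τ∘σ-polarity
    }

filiform-isTotalOrder : ∀ {G} → IsFiliform G → IsTotalOrder _≡_ (_≤_ G)
filiform-isTotalOrder G-filiform = record
  { isPartialOrder = IsGame.isPartialOrder (IsFiliform.isGame G-filiform)
  ; total          = IsFiliform.total G-filiform
  }

corollary1 : (A B C : Arena) → IsFiliform A → IsFiliform B → IsFiliform C →
    (σ : Rel (M (A ⊸ B)) 0ℓ) → (τ : Rel (M (B ⊸ C)) 0ℓ) →
    IsStrategy (A ⊸ B) σ → IsStrategy (B ⊸ C) τ →
    IsStrategy (A ⊸ C) (compose A B C σ τ)
corollary1 A B C _ B-filiform _ σ τ σ-strategy τ-strategy =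
  Composition.isStrategy A B C (filiform-isTotalOrder B-filiform) σ τ σ-strategy τ-strategy
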